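{- The type B Prüfer code map is a bijection from $BT_n$ to the set $S_B=\{(b_1,\dots,b_n)\mid b_i\in[n]\}$.
   Context: $BT_n$ is the set of rooted labeled trees on vertex set $[n]$ with a loop attached to one of the vertices. The type B Prüfer code $(b_1,\dots,b_n)$ of such a graph is constructed as follows: record the label of the root as $b_1$; remove the loop; let $v$ be the vertex the loop was attached to, and regard the tree as rooted at $v$; then repeatedly pick the leaf (non-root vertex with no children) with smallest label, record the label of its parent as the next entry, and delete that leaf; stop when one vertex remains. The entries recorded after $b_1$ are $b_2,\dots,b_n$. -}

module Defs where

open import Data.Nat using (ℕ; zero; suc; _+_; _≡ᵇ_)
open import Data.Bool using (Bool; true; false; _∧_; not; if_then_else_)
open import Data.Fin using (Fin; zero; suc; _≟_)
open import Data.Fin.Properties using () renaming (_≟_ to _≟F_)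
open import Data.Maybe using (Maybe; just; nothing)
open import Data.List using (List; []; _∷_; length)
open import Data.List.Relation.Unary.Unique.Propositional using (Unique)
open import Data.Vec using (Vec; []; _∷_)
open import Data.Product using (Σ; ∃; _×_; _,_)
open import Relation.Binary.PropositionalEquality using (_≡_)
open import Relation.Nullary using (¬_; does)

-- Simple graphs on the vertex set Fin n (labels 0..n-1 stand for [n]).
-- A graph is given by its (decidable) adjacency relation.

Adj : ℕ → Set
Adj n = Fin n → Fin n → Bool

data Walk {n : ℕ} (G : Adj n) : Fin n → Fin n → Set where
  here  : ∀ {x} → Walk G x x
  step  : ∀ {x y z} → G x y ≡ true → Walk G y z → Walk G x z

Connected : ∀ {n} → Adj n → Set
Connected G = ∀ x y → Walk G x y

data Chain {n : ℕ} (G : Adj n) : Fin n → List (Fin n) → Fin n → Set where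
  end  : ∀ {x} → Chain G x [] x
  link : ∀ {x y ys z} → G x y ≡ true → Chain G y ys z → Chain G x (y ∷ ys) z

record Cycle {n : ℕ} (G : Adj n) : Set where
  field
    start  : Fin n
    rest   : List (Fin n)
    last   : Fin n
    long   : 2 Data.Nat.≤ length rest
    chain  : Chain G start rest last
    closes : G last start ≡ true
    distinct : Unique (start ∷ rest)

Acyclic : ∀ {n} → Adj n → Set
Acyclic G = ¬ Cycle G

record IsTree {n : ℕ} (G : Adj n) : Set where
  field
    symmetric : ∀ x y → G x y ≡ G y x
    loopless  : ∀ x → G x x ≡ false
    connected : Connected G
    acyclic   : Acyclic G

-- BT_n : rooted labeled trees on [n] with a loop attached to one vertex.

record BT (n : ℕ) : Set where
  field
    adj    : Adj n
    isTree : IsTree adj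
    root   : Fin n
    loopAt : Fin n
open BT public

_≈BT_ : ∀ {n} → BT n → BT n → Set
s ≈BT t = (∀ x y → adj s x y ≡ adj t x y) × root s ≡ root t × loopAt s ≡ loopAt t

_==_ : ∀ {n} → Fin n → Fin n → Bool
x == y = does (x ≟F y)

firstFin : ∀ {n} → (Fin n → Bool) → Maybe (Fin n)
firstFin {zero}  p = nothing
firstFin {suc n} p with p zero
... | true  = just zero
... | false with firstFin {n} (λ i → p (suc i))
...   | just i  = just (suc i)
...   | nothing = nothing

countFin : ∀ {n} → (Fin n → Bool) → ℕ
countFin {zero}  p = 0
countFin {suc n} p = (if p zero then 1 else 0) + countFin (λ i → p (suc i))

degIn : ∀ {n} → Adj n → (Fin n → Bool) → Fin n → ℕ
degIn G alive x = countFin (λ y → alive y ∧ G x y)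

-- In the (sub)tree rooted at v, a leaf is a non-root vertex with no
-- children, i.e. a non-root vertex whose only remaining neighbour is its
-- parent (degree 1).  The parent of a leaf is its unique remaining neighbour.
isLeaf : ∀ {n} → Adj n → Fin n → (Fin n → Bool) → Fin n → Bool
isLeaf G v alive x = alive x ∧ not (x == v) ∧ (degIn G alive x ≡ᵇ 1)

-- Perform k leaf deletions, recording the parents.  (The fallback branch
-- never happens for trees; it only makes the function total.)
pruferSteps : ∀ {n} → Adj n → Fin n → (Fin n → Bool) → (k : ℕ) → Vec (Fin n) k
pruferSteps G v alive zero = []
pruferSteps G v alive (suc k) with firstFin (isLeaf G v alive)
... | nothing = v ∷ pruferSteps G v alive k
... | just ℓ with firstFin (λ y → alive y ∧ G ℓ y)
...   | nothing = v ∷ pruferSteps G v alive k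
...   | just p  = p ∷ pruferSteps G v (λ y → alive y ∧ not (y == ℓ)) k

pruferB : ∀ {m} → BT (suc m) → Vec (Fin (suc m)) (suc m)
pruferB {m} t = root t ∷ pruferSteps (adj t) (loopAt t) (λ _ → true) m

-- Deleting the least leaf ℓ of a tree rooted at v records the unique neighbour p of ℓ and leaves a
-- tree rooted at v with one vertex fewer, so everything is stated for the subtree spanned by the set
-- A of vertices still alive in pruferSteps. By induction, an alive vertex other than v is a leaf iff
-- it does not occur in the code, and a nonempty code ends with v. Hence the code determines ℓ (the
-- least alive vertex absent from it), p (its first entry) and, recursively, the remaining edges and
-- the loop vertex: the map is injective. Conversely, a sequence ending in v is decoded by taking the
-- least absent vertex ℓ, decoding the tail on the other vertices and grafting ℓ onto the first entry;
-- ℓ is then the least leaf of the result, whose code is therefore the given sequence.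

{-# OPTIONS --safe #-}
module Submission where

open import Defs
open import Data.Bool using (Bool; true; false; _∧_; _∨_; not; if_then_else_; T)
open import Data.Bool.Properties
  using (∧-conicalˡ; ∧-conicalʳ; ∨-conicalˡ; ∨-conicalʳ; ∧-identityʳ; ∧-zeroʳ; ∨-identityʳ; ∨-zeroʳ;
         ∧-assoc; ∧-comm; ∨-comm; not-injective)
open import Data.Empty using (⊥; ⊥-elim)
open import Data.Fin using (Fin; zero; suc)
open import Data.Fin.Properties using (_≟_)
open import Data.List using (List; []; _∷_; length; take)
open import Data.List.Membership.Propositional using (_∈_; _∉_)
open import Data.List.Relation.Unary.All using (All; []; _∷_)
import Data.List.Relation.Unary.All as All
open import Data.List.Relation.Unary.All.Properties using (¬Any⇒All¬)
open import Data.List.Relation.Unary.AllPairs using ([]; _∷_)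
open import Data.List.Relation.Unary.Any using (here; there)
open import Data.List.Relation.Unary.Unique.Propositional using (Unique)
open import Data.List.Relation.Unary.Unique.Propositional.Properties using (take⁺; Unique[x∷xs]⇒x∉xs)
open import Data.Maybe using (just; nothing)
open import Data.Maybe.Properties using (just-injective)
open import Data.Nat using (ℕ; zero; suc; _+_; _≡ᵇ_; _≤_; z≤n; s≤s)
open import Data.Nat.Properties
  using (+-comm; +-assoc; +-identityʳ; +-monoˡ-≤; +-monoʳ-≤; suc-injective; ≤-reflexive; <-irrefl;
         m≤n+m; 0≢1+n; ≡ᵇ⇒≡; module ≤-Reasoning)
  renaming (_≟_ to _≟ℕ_)
open import Data.Product using (Σ; ∃; _×_; _,_; proj₁; proj₂)
open import Data.Sum using (_⊎_; inj₁; inj₂)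
open import Data.Unit using (⊤; tt)
open import Data.Vec using (Vec; []; _∷_; toList)
open import Data.Vec.Properties using (length-toList; ∷-injectiveˡ; ∷-injectiveʳ)
open import Function using (_∘_)
open import Relation.Binary.PropositionalEquality
open import Relation.Nullary using (Dec; yes; no)
open import Relation.Nullary.Decidable using (dec-true; dec-false)

false≢true : false ≢ true
false≢true ()

==⇒≡ : ∀ {n} {x y : Fin n} → (x == y) ≡ true → x ≡ y
==⇒≡ {x = x} {y} e with x ≟ y
... | yes x≡y = x≡y
... | no _    = ⊥-elim (false≢true e)

==-false⇒≢ : ∀ {n} {x y : Fin n} → (x == y) ≡ false → x ≢ y
==-false⇒≢ {x = x} {y} e with x ≟ y
... | yes x≡y = ⊥-elim (false≢true (sym e))
... | no x≢y  = x≢y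

==-refl : ∀ {n} (x : Fin n) → (x == x) ≡ true
==-refl x = dec-true (x ≟ x) refl

≡⇒== : ∀ {n} {x y : Fin n} → x ≡ y → (x == y) ≡ true
≡⇒== {x = x} {y} = dec-true (x ≟ y)

≢⇒==-false : ∀ {n} {x y : Fin n} → x ≢ y → (x == y) ≡ false
≢⇒==-false {x = x} {y} = dec-false (x ≟ y)

indicator : Bool → ℕ
indicator b = if b then 1 else 0

indicator≤1 : ∀ b → indicator b ≤ 1
indicator≤1 true  = s≤s z≤n
indicator≤1 false = z≤n

+1≢ᵇ1 : ∀ {d} → 1 ≤ d → (d + 1 ≡ᵇ 1) ≡ false
+1≢ᵇ1 {suc d} _ rewrite +-comm d 1 = refl

_without_ : ∀ {n} → (Fin n → Bool) → Fin n → Fin n → Bool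
(A without ℓ) y = A y ∧ not (y == ℓ)

module _ {n} (A : Fin n → Bool) (ℓ : Fin n) {y : Fin n} where

  without-intro : A y ≡ true → y ≢ ℓ → (A without ℓ) y ≡ true
  without-intro Ay y≢ℓ rewrite Ay | ≢⇒==-false y≢ℓ = refl

  without-⊆ : (A without ℓ) y ≡ true → A y ≡ true
  without-⊆ = ∧-conicalˡ _ _

  without-≢ : (A without ℓ) y ≡ true → y ≢ ℓ
  without-≢ e = ==-false⇒≢ (not-injective (∧-conicalʳ _ _ e))

without-self : ∀ {n} (A : Fin n → Bool) ℓ → (A without ℓ) ℓ ≡ false
without-self A ℓ rewrite ==-refl ℓ = ∧-zeroʳ (A ℓ)

-- Searching and counting over Fin n

firstFin-sound : ∀ {n} {p : Fin n → Bool} {x} → firstFin p ≡ just x → p x ≡ true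
firstFin-sound {suc n} {p} e with p zero in p0
firstFin-sound {suc n} {p} refl | true = p0
... | false with firstFin (λ i → p (suc i)) in e′
firstFin-sound {suc n} {p} refl | false | just i = firstFin-sound {n} {p ∘ suc} e′

firstFin-nothing : ∀ {n} {p : Fin n → Bool} → firstFin p ≡ nothing → ∀ x → p x ≡ false
firstFin-nothing {suc n} {p} e x with p zero in p0
firstFin-nothing {suc n} {p} () x | true
... | false with firstFin (λ i → p (suc i)) in e′
firstFin-nothing {suc n} {p} () x | false | just i
firstFin-nothing {suc n} {p} refl zero | false | nothing = p0
firstFin-nothing {suc n} {p} refl (suc x) | false | nothing = firstFin-nothing {n} {p ∘ suc} e′ x

firstFin-cong : ∀ {n} {p q : Fin n → Bool} → (∀ x → p x ≡ q x) → firstFin p ≡ firstFin q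
firstFin-cong {zero} e = refl
firstFin-cong {suc n} {p} {q} e with p zero | q zero | e zero
... | true  | true  | _ = refl
... | false | false | _ with firstFin (p ∘ suc) | firstFin (q ∘ suc) | firstFin-cong {n} {p ∘ suc} {q ∘ suc} (e ∘ suc)
...   | just i  | .(just i) | refl = refl
...   | nothing | .nothing  | refl = refl

firstFin-complete : ∀ {n} {p : Fin n → Bool} {x} → p x ≡ true → ∃ λ y → firstFin p ≡ just y
firstFin-complete {p = p} {x} px with firstFin p in e
... | just y  = y , refl
... | nothing = ⊥-elim (false≢true (trans (sym (firstFin-nothing e x)) px))

firstFin-unique : ∀ {n} {p : Fin n → Bool} {x} → p x ≡ true → (∀ y → p y ≡ true → y ≡ x) → firstFin p ≡ just x
firstFin-unique px unique with firstFin-complete px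
... | y , e = trans e (cong just (unique y (firstFin-sound e)))

countFin-cong : ∀ {n} {p q : Fin n → Bool} → (∀ x → p x ≡ q x) → countFin p ≡ countFin q
countFin-cong {zero} e = refl
countFin-cong {suc n} {p} {q} e rewrite e zero = cong (_ +_) (countFin-cong {n} {p ∘ suc} {q ∘ suc} (e ∘ suc))

countFin-none : ∀ {n} {p : Fin n → Bool} → (∀ x → p x ≡ false) → countFin p ≡ 0
countFin-none {zero} _ = refl
countFin-none {suc n} {p} none rewrite none zero = countFin-none {n} {p ∘ suc} (none ∘ suc)

countFin-all : ∀ n → countFin {n} (λ _ → true) ≡ n
countFin-all zero    = refl
countFin-all (suc n) = cong suc (countFin-all n)

countFin-remove : ∀ {n} (p : Fin n → Bool) (z : Fin n) → countFin p ≡ countFin (p without z) + indicator (p z)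
countFin-remove {suc n} p zero with p zero
... | true  = trans (cong suc (countFin-cong λ i → sym (∧-identityʳ (p (suc i))))) (+-comm 1 _)
... | false = trans (countFin-cong λ i → sym (∧-identityʳ (p (suc i)))) (sym (+-identityʳ _))
countFin-remove {suc n} p (suc z) with p zero | countFin-remove (p ∘ suc) z
... | true  | ih = cong suc ih
... | false | ih = ih

countFin-zero : ∀ {n} {p : Fin n → Bool} → countFin p ≡ 0 → ∀ x → p x ≡ false
countFin-zero {suc n} {p} e x with p zero in p0
countFin-zero {suc n} {p} () x | true
countFin-zero {suc n} {p} e zero | false = p0
countFin-zero {suc n} {p} e (suc x) | false = countFin-zero {n} {p ∘ suc} e x

countFin-witness : ∀ {n} {p : Fin n → Bool} → countFin p ≢ 0 → ∃ λ x → p x ≡ true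
countFin-witness {p = p} c≢0 with firstFin p in e
... | just x  = x , firstFin-sound e
... | nothing = ⊥-elim (c≢0 (countFin-none (firstFin-nothing e)))

countFin-pos : ∀ {n} {p : Fin n → Bool} {x} → p x ≡ true → 1 ≤ countFin p
countFin-pos {p = p} {x} px rewrite countFin-remove p x | px = m≤n+m 1 _

countFin-without : ∀ {n k} {A : Fin n → Bool} (ℓ : Fin n) → A ℓ ≡ true → countFin A ≡ suc k → countFin (A without ℓ) ≡ k
countFin-without {A = A} ℓ Aℓ size = suc-injective (begin
  suc (countFin (A without ℓ))               ≡⟨ +-comm 1 _ ⟩
  countFin (A without ℓ) + indicator true    ≡⟨ cong (λ b → countFin (A without ℓ) + indicator b) (sym Aℓ) ⟩
  countFin (A without ℓ) + indicator (A ℓ)   ≡⟨ sym (countFin-remove A ℓ) ⟩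
  countFin A                                 ≡⟨ size ⟩
  suc _                                      ∎)
  where open ≡-Reasoning

countFin-single : ∀ {n} {A : Fin n → Bool} {v x} → countFin A ≡ 1 → A v ≡ true → A x ≡ true → x ≡ v
countFin-single {A = A} {v} {x} size Av Ax with x ≟ v
... | yes x≡v = x≡v
... | no x≢v  = ⊥-elim (false≢true (trans (sym (countFin-zero (countFin-without v Av size) x)) (without-intro A v Ax x≢v)))

countFin-only : ∀ {n} {p : Fin n → Bool} {x} → p x ≡ true → (∀ y → p y ≡ true → y ≡ x) → countFin p ≡ 1
countFin-only {p = p} {x} px unique =
  trans (countFin-remove p x) (cong₂ _+_ (countFin-none others) (cong indicator px))
  where
    others : ∀ y → (p without x) y ≡ false
    others y with (p without x) y in e
    ... | false = refl
    ... | true  = ⊥-elim (without-≢ p x e (unique y (without-⊆ p x e)))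

countFin-another : ∀ {n} {p : Fin n → Bool} {x} → p x ≡ true → countFin p ≢ 1 → ∃ λ y → p y ≡ true × y ≢ x
countFin-another {p = p} {x} px c≢1 =
  let y , qy = countFin-witness {p = p without x}
                 (λ c≡0 → c≢1 (trans (countFin-remove p x) (cong₂ _+_ c≡0 (cong indicator px))))
  in y , without-⊆ p x qy , without-≢ p x qy

_∈ᵇ_ : ∀ {n} → Fin n → List (Fin n) → Bool
x ∈ᵇ []       = false
x ∈ᵇ (y ∷ ys) = (x == y) ∨ (x ∈ᵇ ys)

∈ᵇ⇒∈ : ∀ {n} {x : Fin n} ys → x ∈ᵇ ys ≡ true → x ∈ ys
∈ᵇ⇒∈ {x = x} (y ∷ ys) e with x == y in x==y
... | true  = here (==⇒≡ x==y)
... | false = there (∈ᵇ⇒∈ ys e)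

∉ᵇ⇒All≢ : ∀ {n} {x : Fin n} ys → x ∈ᵇ ys ≡ false → All (x ≢_) ys
∉ᵇ⇒All≢ []       _ = []
∉ᵇ⇒All≢ (y ∷ ys) e = ==-false⇒≢ (∨-conicalˡ _ _ e) ∷ ∉ᵇ⇒All≢ ys (∨-conicalʳ _ _ e)

∈ᵇ-∷⁻ : ∀ {n} {x y : Fin n} ys → x ∈ᵇ (y ∷ ys) ≡ true → x ≡ y ⊎ x ∈ᵇ ys ≡ true
∈ᵇ-∷⁻ {x = x} {y} ys e with x == y in x==y
... | true  = inj₁ (==⇒≡ x==y)
... | false = inj₂ e

_outside_ : ∀ {n} → (Fin n → Bool) → List (Fin n) → Fin n → Bool
(A outside L) x = A x ∧ not (x ∈ᵇ L)

outside-intro : ∀ {n} (A : Fin n → Bool) L {x} → A x ≡ true → x ∈ᵇ L ≡ false → (A outside L) x ≡ true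
outside-intro A L Ax x∉L rewrite Ax | x∉L = refl

outside-alive : ∀ {n} (A : Fin n → Bool) L {x} → A x ≡ true → (A outside L) x ≡ not (x ∈ᵇ L)
outside-alive A L {x} Ax = cong (_∧ not (x ∈ᵇ L)) Ax

outside-dead : ∀ {n} (A : Fin n → Bool) L {x} → A x ≡ false → (A outside L) x ≡ false
outside-dead A L {x} Ax = cong (_∧ not (x ∈ᵇ L)) Ax

outside-present : ∀ {n} (A : Fin n → Bool) L x → x ∈ᵇ L ≡ true → (A outside L) x ≡ false
outside-present A L x x∈ = trans (cong (λ b → A x ∧ not b) x∈) (∧-zeroʳ (A x))

∷-∈ᵇ-head : ∀ {n} (x : Fin n) L → x ∈ᵇ (x ∷ L) ≡ true
∷-∈ᵇ-head x L = cong (_∨ (x ∈ᵇ L)) (==-refl x)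

outside-∷ : ∀ {n} (A : Fin n → Bool) y L x → (A outside (y ∷ L)) x ≡ ((A outside L) without y) x
outside-∷ A y L x = lemma (A x) (x == y) (x ∈ᵇ L)
  where
    lemma : ∀ a c m → a ∧ not (c ∨ m) ≡ (a ∧ not m) ∧ not c
    lemma false _     _     = refl
    lemma true  true  true  = refl
    lemma true  true  false = refl
    lemma true  false true  = refl
    lemma true  false false = refl

countFin-outside-∷ : ∀ {n f} {A : Fin n → Bool} {y L} → (A outside L) y ≡ true →
                     countFin (A outside L) ≡ suc f → countFin (A outside (y ∷ L)) ≡ f
countFin-outside-∷ {A = A} {y} {L} fresh size =
  trans (countFin-cong (outside-∷ A y L)) (countFin-without y fresh size)

countFin-≤-outside : ∀ {n} (A : Fin n → Bool) L → countFin A ≤ countFin (A outside L) + length L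
countFin-≤-outside A [] = ≤-reflexive (trans (countFin-cong λ x → sym (∧-identityʳ (A x))) (sym (+-identityʳ _)))
countFin-≤-outside A (y ∷ L) = begin
  countFin A                                                      ≤⟨ countFin-≤-outside A L ⟩
  countFin (A outside L) + length L                               ≡⟨ cong (_+ length L) (countFin-remove (A outside L) y) ⟩
  countFin ((A outside L) without y) + indicator ((A outside L) y) + length L
    ≤⟨ +-monoˡ-≤ (length L) (+-monoʳ-≤ (countFin ((A outside L) without y)) (indicator≤1 _)) ⟩
  countFin ((A outside L) without y) + 1 + length L               ≡⟨ +-assoc _ 1 (length L) ⟩
  countFin ((A outside L) without y) + length (y ∷ L)             ≡⟨ cong (_+ length (y ∷ L)) (countFin-cong λ x → sym (outside-∷ A y L x)) ⟩
  countFin (A outside (y ∷ L)) + length (y ∷ L)                   ∎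
  where open ≤-Reasoning

least-absent : ∀ {n k} {A : Fin n → Bool} (c : Vec (Fin n) k) → countFin A ≡ suc k →
               ∃ λ ℓ → firstFin (A outside toList c) ≡ just ℓ
least-absent {k = k} {A} c size = firstFin-complete (proj₂ (countFin-witness {p = A outside toList c} λ none → <-irrefl refl (begin
  suc k                                                    ≡⟨ sym size ⟩
  countFin A                                               ≤⟨ countFin-≤-outside A (toList c) ⟩
  countFin (A outside toList c) + length (toList c)        ≡⟨ cong₂ _+_ none (length-toList c) ⟩
  k                                                        ∎)))
  where open ≤-Reasoning

LastIs : ∀ {X : Set} {k} → Vec X k → X → Set
LastIs []           v = ⊤
LastIs (x ∷ [])     v = x ≡ v
LastIs (x ∷ y ∷ ys) v = LastIs (y ∷ ys) v

lastIs-exists : ∀ {X : Set} {k} → X → (xs : Vec X k) → ∃ (LastIs xs)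
lastIs-exists d []           = d , tt
lastIs-exists d (x ∷ [])     = x , refl
lastIs-exists d (x ∷ y ∷ ys) = lastIs-exists d (y ∷ ys)

lastIs-unique : ∀ {X : Set} {k} (xs : Vec X (suc k)) {v w} → LastIs xs v → LastIs xs w → v ≡ w
lastIs-unique (x ∷ [])     x≡v x≡w = trans (sym x≡v) x≡w
lastIs-unique (x ∷ y ∷ ys) v   w   = lastIs-unique (y ∷ ys) v w

lastIs-∷ : ∀ {X : Set} {k} (x : X) (ys : Vec X (suc k)) {v} → LastIs ys v → LastIs (x ∷ ys) v
lastIs-∷ x (y ∷ ys) last = last

lastIs-tail : ∀ {X : Set} {k} {x : X} (ys : Vec X k) {v} → LastIs (x ∷ ys) v → LastIs ys v
lastIs-tail []       _    = tt
lastIs-tail (y ∷ ys) last = last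

lastIs-∈ᵇ : ∀ {n k} (x : Fin n) (ys : Vec (Fin n) k) {v} → LastIs (x ∷ ys) v → v ∈ᵇ toList (x ∷ ys) ≡ true
lastIs-∈ᵇ x [] refl rewrite ==-refl x = refl
lastIs-∈ᵇ x (y ∷ ys) {v} last rewrite lastIs-∈ᵇ y ys last = ∨-zeroʳ (v == x)

-- Forests, paths and cycles

chain-end∈ : ∀ {n} {G : Adj n} {a ys z} → Chain G a ys z → z ∈ (a ∷ ys)
chain-end∈ end        = here refl
chain-end∈ (link _ c) = there (chain-end∈ c)

chain-last-edge : ∀ {n} {G : Adj n} {a y ys z} → Chain G a (y ∷ ys) z → ∃ λ u → G u z ≡ true × u ∈ (a ∷ y ∷ ys)
chain-last-edge {a = a} (link g end) = a , g , here refl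
chain-last-edge (link _ c@(link _ _)) with chain-last-edge c
... | u , g , u∈ = u , g , there u∈

chain-prefix : ∀ {n} {G : Adj n} {a x xs z y} → Chain G a (x ∷ xs) z → y ∈ (x ∷ xs) →
               ∃ λ k → Chain G a (x ∷ take k xs) y
chain-prefix (link g _)           (here refl) = 0 , link g end
chain-prefix (link g end)         (there ())
chain-prefix (link g (link g′ c)) (there y∈) with chain-prefix (link g′ c) y∈
... | k , c′ = suc k , link g c′

chord-cycle : ∀ {n} {G : Adj n} {cur pred R z y} → Chain G cur (pred ∷ R) z → Unique (cur ∷ pred ∷ R) →
              y ∈ R → G y cur ≡ true → Cycle G
chord-cycle (link g end) _ () _
chord-cycle {cur = cur} {pred} (link g (link g′ c)) u y∈R closes with chain-prefix (link g′ c) y∈R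
... | k , c′ = record { start = cur ; rest = pred ∷ _ ; last = _ ; long = s≤s (s≤s z≤n)
                      ; chain = link g c′ ; closes = closes ; distinct = take⁺ (3 + k) u }

record IsForest {n} (G : Adj n) : Set where
  field
    symmetric : ∀ x y → G x y ≡ G y x
    loopless  : ∀ x → G x x ≡ false
    acyclic   : Acyclic G
open IsForest public

data WalkIn {n} (G : Adj n) (A : Fin n → Bool) : Fin n → Fin n → Set where
  here : ∀ {x} → WalkIn G A x x
  step : ∀ {x y z} → A y ≡ true → G x y ≡ true → WalkIn G A y z → WalkIn G A x z

_++ʷ_ : ∀ {n} {G : Adj n} {A x y z} → WalkIn G A x y → WalkIn G A y z → WalkIn G A x z
here       ++ʷ w′ = w′
step a g w ++ʷ w′ = step a g (w ++ʷ w′)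

ConnectedIn : ∀ {n} → Adj n → (Fin n → Bool) → Set
ConnectedIn G A = ∀ x y → A x ≡ true → A y ≡ true → WalkIn G A x y

record Subtree {n} (G : Adj n) (v : Fin n) (A : Fin n → Bool) (k : ℕ) : Set where
  field
    root-alive : A v ≡ true
    size       : countFin A ≡ suc k
    connected  : ConnectedIn G A
open Subtree public

module Pendant {n} {G : Adj n} (G-symmetric : ∀ x y → G x y ≡ G y x) {ℓ p : Fin n}
               (pendant : ∀ y → G ℓ y ≡ true → y ≡ p) where

  pendant-interior : ∀ {a ys z} → Chain G a ys z → Unique (a ∷ ys) → ℓ ∈ ys → ℓ ≢ z → ⊥
  pendant-interior (link g end) _ (here refl) ℓ≢z = ℓ≢z refl
  pendant-interior {a} (link g (link {y = b} g′ _)) ((_ ∷ a≢b ∷ _) ∷ _) (here refl) _ =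
    a≢b (trans (pendant a (trans (G-symmetric ℓ a) g)) (sym (pendant b g′)))
  pendant-interior (link _ c) (_ ∷ u) (there ℓ∈) ℓ≢z = pendant-interior c u ℓ∈ ℓ≢z

  pendant-off-cycle : (C : Cycle G) → ℓ ∉ (Cycle.start C ∷ Cycle.rest C)
  pendant-off-cycle record { rest = [] ; long = () }
  pendant-off-cycle record { rest = _ ∷ [] ; long = s≤s () }
  pendant-off-cycle record { rest = y₁ ∷ _ ∷ _ ; last = l ; chain = link g₁ (link _ c₂) ; closes = cl
                           ; distinct = _ ∷ (y₁∉ ∷ _) } (here refl) =
    All.lookup y₁∉ (chain-end∈ c₂) (trans (pendant y₁ g₁) (sym (pendant l (trans (G-symmetric ℓ l) cl))))
  pendant-off-cycle record { start = s ; rest = _ ∷ _ ∷ _ ; last = l ; chain = ch ; closes = cl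
                           ; distinct = d } (there ℓ∈) with ℓ ≟ l
  ... | no ℓ≢l = pendant-interior ch d ℓ∈ ℓ≢l
  pendant-off-cycle record { start = s ; rest = _ ∷ _ ∷ _ ; chain = link _ c₁ ; closes = cl
                           ; distinct = s∉ ∷ _ } (there ℓ∈) | yes refl with chain-last-edge c₁
  ... | u , g , u∈ = All.lookup s∉ u∈ (trans (pendant s cl) (sym (pendant u (trans (G-symmetric ℓ u) g))))

-- Pruning the least leaf

adjacent-≢ : ∀ {n} {G : Adj n} → IsForest G → ∀ {x y} → G x y ≡ true → x ≢ y
adjacent-≢ F {x} g refl = false≢true (trans (sym (loopless F x)) g)

isLeaf-test : ∀ {n} (G : Adj n) v A {x} → A x ≡ true → x ≢ v → isLeaf G v A x ≡ (degIn G A x ≡ᵇ 1)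
isLeaf-test G v A Ax x≢v rewrite Ax | ≢⇒==-false x≢v = refl

isLeaf-dead : ∀ {n} (G : Adj n) v A {x} → A x ≡ false → isLeaf G v A x ≡ false
isLeaf-dead G v A {x} Ax = cong (_∧ (not (x == v) ∧ (degIn G A x ≡ᵇ 1))) Ax

isLeaf-root : ∀ {n} (G : Adj n) v A → isLeaf G v A v ≡ false
isLeaf-root G v A = trans (cong (λ b → A v ∧ (not b ∧ (degIn G A v ≡ᵇ 1))) (==-refl v)) (∧-zeroʳ (A v))

isLeaf-elim : ∀ {n} {G : Adj n} {v A x} → isLeaf G v A x ≡ true → A x ≡ true × x ≢ v × degIn G A x ≡ 1
isLeaf-elim {G = G} {v} {A} {x} e =
  ∧-conicalˡ _ _ e , ==-false⇒≢ (not-injective (∧-conicalˡ _ _ rest)) , ≡ᵇ⇒≡ _ 1 (subst T (sym (∧-conicalʳ _ _ rest)) tt)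
  where rest = ∧-conicalʳ (A x) _ e

degIn-without : ∀ {n} (G : Adj n) {A : Fin n → Bool} {ℓ} x → A ℓ ≡ true →
                degIn G A x ≡ degIn G (A without ℓ) x + indicator (G x ℓ)
degIn-without G {A} {ℓ} x Aℓ = trans (countFin-remove (λ y → A y ∧ G x y) ℓ)
  (cong₂ _+_ (countFin-cong λ y → swap (A y) (G x y) (not (y == ℓ))) (cong (λ b → indicator (b ∧ G x ℓ)) Aℓ))
  where
    swap : ∀ a g b → (a ∧ g) ∧ b ≡ (a ∧ b) ∧ g
    swap a g b = trans (∧-assoc a g b) (trans (cong (a ∧_) (∧-comm g b)) (sym (∧-assoc a b g)))

AgreeOn : ∀ {n} → (Fin n → Bool) → Adj n → Adj n → Set
AgreeOn A G H = ∀ x y → A x ≡ true → A y ≡ true → G x y ≡ H x y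

alive-neighbours-cong : ∀ {n} {G H : Adj n} {A} → AgreeOn A G H → ∀ {x} → A x ≡ true → ∀ y → (A y ∧ G x y) ≡ (A y ∧ H x y)
alive-neighbours-cong {A = A} agree {x} Ax y with A y in Ay
... | false = refl
... | true  = agree x y Ax Ay

isLeaf-cong : ∀ {n} {G H : Adj n} {v A} → AgreeOn A G H → ∀ x → isLeaf G v A x ≡ isLeaf H v A x
isLeaf-cong {v = v} {A} agree x with A x in Ax
... | false = refl
... | true  = cong (λ d → not (x == v) ∧ (d ≡ᵇ 1)) (countFin-cong (alive-neighbours-cong agree Ax))

pruferSteps-unfold : ∀ {n} (G : Adj n) v A k {ℓ p} → firstFin (isLeaf G v A) ≡ just ℓ →
                     firstFin (λ y → A y ∧ G ℓ y) ≡ just p → pruferSteps G v A (suc k) ≡ p ∷ pruferSteps G v (A without ℓ) k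
pruferSteps-unfold G v A k first-leaf first-neighbour rewrite first-leaf | first-neighbour = refl

pruferSteps-cong : ∀ {n} {G H : Adj n} {v A} k → AgreeOn A G H → pruferSteps G v A k ≡ pruferSteps H v A k
pruferSteps-cong zero agree = refl
pruferSteps-cong {G = G} {H} {v} {A} (suc k) agree
  rewrite firstFin-cong (isLeaf-cong {v = v} agree) with firstFin (isLeaf H v A) in first-leaf
... | nothing = cong (v ∷_) (pruferSteps-cong k agree)
... | just ℓ rewrite firstFin-cong (alive-neighbours-cong agree (∧-conicalˡ _ _ (firstFin-sound first-leaf)))
  with firstFin (λ y → A y ∧ H ℓ y)
...   | nothing = cong (v ∷_) (pruferSteps-cong k agree)
...   | just p  = cong (p ∷_) (pruferSteps-cong k λ x y x∈ y∈ → agree x y (without-⊆ A ℓ x∈) (without-⊆ A ℓ y∈))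

record Pruning {n} (G : Adj n) (v : Fin n) (A : Fin n → Bool) (k : ℕ) : Set where
  field
    leaf parent     : Fin n
    first-leaf      : firstFin (isLeaf G v A) ≡ just leaf
    first-neighbour : firstFin (λ y → A y ∧ G leaf y) ≡ just parent
    leaf-alive      : A leaf ≡ true
    leaf-degree     : degIn G A leaf ≡ 1
    parent-alive    : A parent ≡ true
    parent-edge     : G leaf parent ≡ true
    parent-unique   : ∀ y → A y ≡ true → G leaf y ≡ true → y ≡ parent
    parent≢leaf     : parent ≢ leaf
    remaining       : Subtree G v (A without leaf) k
open Pruning public

pruferSteps-prune : ∀ {n} {G : Adj n} {v A k} (P : Pruning G v A k) →
                    pruferSteps G v A (suc k) ≡ parent P ∷ pruferSteps G v (A without leaf P) k
pruferSteps-prune {G = G} {v} {A} {k} P = pruferSteps-unfold G v A k (first-leaf P) (first-neighbour P)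

module _ {n} {G : Adj n} (F : IsForest G) where

  leaf-or-next : ∀ {v A cur pred R} → Chain G cur (pred ∷ R) v → Unique (cur ∷ pred ∷ R) →
                 All (λ x → A x ≡ true) (cur ∷ pred ∷ R) →
                 isLeaf G v A cur ≡ true ⊎ ∃ λ y → A y ≡ true × G cur y ≡ true × y ∈ᵇ (cur ∷ pred ∷ R) ≡ false
  leaf-or-next {v} {A} {cur} {pred} {R} ch@(link g c) u (Acur ∷ Apred ∷ _) with degIn G A cur ≟ℕ 1
  ... | yes deg≡1 = inj₁ (trans (isLeaf-test G v A Acur cur≢v) (cong (_≡ᵇ 1) deg≡1))
    where
      cur≢v : cur ≢ v
      cur≢v refl = Unique[x∷xs]⇒x∉xs u (chain-end∈ c)
  ... | no deg≢1 with countFin-another {p = λ y → A y ∧ G cur y} (trans (cong (_∧ G cur pred) Apred) g) deg≢1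
  ...   | y , Ay∧g , y≢pred with y ∈ᵇ (cur ∷ pred ∷ R) in y∈?
  ...     | false = inj₂ (y , ∧-conicalˡ _ _ Ay∧g , ∧-conicalʳ _ _ Ay∧g , y∈?)
  ...     | true with ∈ᵇ⇒∈ {x = y} (cur ∷ pred ∷ R) y∈?
  ...       | here refl         = ⊥-elim (adjacent-≢ F (∧-conicalʳ _ _ Ay∧g) refl)
  ...       | there (here refl) = ⊥-elim (y≢pred refl)
  ...       | there (there y∈R) =
    ⊥-elim (acyclic F (chord-cycle ch u y∈R (trans (symmetric F y cur) (∧-conicalʳ _ _ Ay∧g))))

  -- A simple path from v that cannot be extended ends in a leaf; fuel counts the unvisited alive vertices.
  grow : ∀ {v A} fuel cur pred R → Chain G cur (pred ∷ R) v → Unique (cur ∷ pred ∷ R) →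
         All (λ x → A x ≡ true) (cur ∷ pred ∷ R) → countFin (A outside (cur ∷ pred ∷ R)) ≡ fuel →
         ∃ λ ℓ → isLeaf G v A ℓ ≡ true
  grow {v} {A} fuel cur pred R ch u alive count with leaf-or-next ch u alive
  ... | inj₁ leaf = cur , leaf
  grow {A = A} zero    cur pred R ch u alive count | inj₂ (y , Ay , _ , y∉) =
    ⊥-elim (false≢true (trans (sym (countFin-zero count y)) (outside-intro A (cur ∷ pred ∷ R) Ay y∉)))
  grow {A = A} (suc f) cur pred R ch u alive count | inj₂ (y , Ay , g , y∉) =
    grow f y cur (pred ∷ R) (link (trans (symmetric F y cur) g) ch) (∉ᵇ⇒All≢ (cur ∷ pred ∷ R) y∉ ∷ u)
         (Ay ∷ alive) (countFin-outside-∷ {A = A} {y} {cur ∷ pred ∷ R} (outside-intro A (cur ∷ pred ∷ R) Ay y∉) count)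

  leaf-exists : ∀ {v A j} → Subtree G v A (suc j) → ∃ λ ℓ → isLeaf G v A ℓ ≡ true
  leaf-exists {v} {A} S
    with countFin-witness {p = A without v} (λ c≡0 → 0≢1+n (trans (sym c≡0) (countFin-without v (root-alive S) (size S))))
  ... | x , x∈ with connected S v x (root-alive S) (without-⊆ A v x∈)
  ...   | here = ⊥-elim (without-≢ A v x∈ refl)
  ...   | step {y = u} Au g _ =
    grow _ u v [] (link (trans (symmetric F u v) g) end) ((≢-sym (adjacent-≢ F g) ∷ []) ∷ [] ∷ []) (Au ∷ root-alive S ∷ []) refl

  -- A walk through ℓ enters and leaves it via its only neighbour p, so the visit can be cut out.
  walk-avoiding : ∀ {A ℓ p a b} → (∀ y → A y ≡ true → G ℓ y ≡ true → y ≡ p) → p ≢ ℓ →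
                  A a ≡ true → a ≢ ℓ → b ≢ ℓ → WalkIn G A a b → WalkIn G (A without ℓ) a b
  walk-avoiding unique p≢ℓ Aa a≢ℓ b≢ℓ here = here
  walk-avoiding {A} {ℓ} {p} {a} {b} unique p≢ℓ Aa a≢ℓ b≢ℓ (step {y = y} Ay g w) with y ≟ ℓ
  ... | no y≢ℓ = step (without-intro A ℓ Ay y≢ℓ) g (walk-avoiding unique p≢ℓ Ay y≢ℓ b≢ℓ w)
  ... | yes refl with w
  ...   | here = ⊥-elim (b≢ℓ refl)
  ...   | step {y = z} Az g′ w′ =
    subst (λ t → WalkIn G (A without ℓ) t b) (trans z≡p (sym a≡p)) (walk-avoiding unique p≢ℓ Az z≢ℓ b≢ℓ w′)
    where
      a≡p : a ≡ p
      a≡p = unique a Aa (trans (symmetric F ℓ a) g)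
      z≡p : z ≡ p
      z≡p = unique z Az g′
      z≢ℓ : z ≢ ℓ
      z≢ℓ z≡ℓ = p≢ℓ (trans (sym z≡p) z≡ℓ)

  prune : ∀ {v A j} → Subtree G v A (suc j) → Pruning G v A j
  prune {v} {A} {j} S = record
    { leaf = ℓ ; parent = p ; first-leaf = proj₂ least-leaf ; first-neighbour = proj₂ least-neighbour
    ; leaf-alive = Aℓ ; leaf-degree = deg ; parent-alive = ∧-conicalˡ _ _ Ap∧g ; parent-edge = ∧-conicalʳ _ _ Ap∧g
    ; parent-unique = unique ; parent≢leaf = ≢-sym (adjacent-≢ F (∧-conicalʳ _ _ Ap∧g))
    ; remaining = record
      { root-alive = without-intro A ℓ (root-alive S) (≢-sym ℓ≢v)
      ; size       = countFin-without ℓ Aℓ (size S)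
      ; connected  = λ x y x∈ y∈ → walk-avoiding unique (≢-sym (adjacent-≢ F (∧-conicalʳ _ _ Ap∧g)))
                       (without-⊆ A ℓ x∈) (without-≢ A ℓ x∈) (without-≢ A ℓ y∈)
                       (connected S x y (without-⊆ A ℓ x∈) (without-⊆ A ℓ y∈)) } }
    where
      least-leaf : ∃ λ ℓ → firstFin (isLeaf G v A) ≡ just ℓ
      least-leaf = firstFin-complete (proj₂ (leaf-exists S))
      ℓ = proj₁ least-leaf
      leaf-facts : A ℓ ≡ true × ℓ ≢ v × degIn G A ℓ ≡ 1
      leaf-facts = isLeaf-elim {G = G} {v} {A} (firstFin-sound (proj₂ least-leaf))
      Aℓ = proj₁ leaf-facts
      ℓ≢v = proj₁ (proj₂ leaf-facts)
      deg = proj₂ (proj₂ leaf-facts)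
      least-neighbour : ∃ λ p → firstFin (λ y → A y ∧ G ℓ y) ≡ just p
      least-neighbour = firstFin-complete (proj₂ (countFin-witness {p = λ y → A y ∧ G ℓ y} λ d≡0 → 0≢1+n (trans (sym d≡0) deg)))
      p = proj₁ least-neighbour
      Ap∧g : A p ∧ G ℓ p ≡ true
      Ap∧g = firstFin-sound (proj₂ least-neighbour)
      unique : ∀ y → A y ≡ true → G ℓ y ≡ true → y ≡ p
      unique y Ay g = countFin-single deg Ap∧g (trans (cong (_∧ G ℓ y) Ay) g)

  code-alive : ∀ {v A k x} → Subtree G v A k → x ∈ᵇ toList (pruferSteps G v A k) ≡ true → A x ≡ true
  code-alive {k = zero} _ ()
  code-alive {v} {A} {suc j} {x} S x∈ with P ← prune S
    with ∈ᵇ-∷⁻ {x = x} {parent P} (toList (pruferSteps G v (A without leaf P) j)) (subst (λ c → x ∈ᵇ toList c ≡ true) (pruferSteps-prune P) x∈)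
  ... | inj₁ refl = parent-alive P
  ... | inj₂ x∈′  = without-⊆ A (leaf P) (code-alive (remaining P) x∈′)

  dead-absent : ∀ {v A k x} → Subtree G v A k → A x ≡ false → x ∈ᵇ toList (pruferSteps G v A k) ≡ false
  dead-absent {v} {A} {k} {x} S Ax with x ∈ᵇ toList (pruferSteps G v A k) in x∈
  ... | false = refl
  ... | true  = ⊥-elim (false≢true (trans (sym Ax) (code-alive S x∈)))

  edge-to-leaf : ∀ {v A j} (P : Pruning G v A j) {x} → A x ≡ true → G x (leaf P) ≡ (x == parent P)
  edge-to-leaf P {x} Ax with G x (leaf P) in g
  ... | true  = sym (≡⇒== (parent-unique P x Ax (trans (symmetric F (leaf P) x) g)))
  ... | false = sym (≢⇒==-false λ x≡p → false≢true (trans (sym g)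
                  (trans (cong (λ t → G t (leaf P)) x≡p) (trans (symmetric F (parent P) (leaf P)) (parent-edge P)))))

  degIn-pruned : ∀ {v A j} (P : Pruning G v A j) {x} → A x ≡ true →
                 degIn G A x ≡ degIn G (A without leaf P) x + indicator (x == parent P)
  degIn-pruned {A = A} P {x} Ax =
    trans (degIn-without G x (leaf-alive P)) (cong (λ b → degIn G (A without leaf P) x + indicator b) (edge-to-leaf P Ax))

  degIn-pos : ∀ {v A k x} → Subtree G v A k → A x ≡ true → x ≢ v → 1 ≤ degIn G A x
  degIn-pos {v} {A} {k} {x} S Ax x≢v with connected S x v Ax (root-alive S)
  ... | here = ⊥-elim (x≢v refl)
  ... | step {y = y} Ay g _ = countFin-pos {p = λ y → A y ∧ G x y} {y} (trans (cong (_∧ G x y) Ay) g)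

  leaf-iff-absent : ∀ {v A k x} → Subtree G v A k → A x ≡ true → x ≢ v →
                    (degIn G A x ≡ᵇ 1) ≡ not (x ∈ᵇ toList (pruferSteps G v A k))
  leaf-iff-absent {k = zero} S Ax x≢v = ⊥-elim (x≢v (countFin-single (size S) (root-alive S) Ax))
  leaf-iff-absent {v} {A} {suc j} {x} S Ax x≢v with P ← prune S
    rewrite pruferSteps-prune P with x ≟ leaf P | x ≟ parent P
  ... | yes refl | yes ℓ≡p = ⊥-elim (parent≢leaf P (sym ℓ≡p))
  ... | yes refl | no _ rewrite leaf-degree P | dead-absent (remaining P) (without-self A (leaf P)) = refl
  ... | no x≢ℓ | yes refl rewrite degIn-pruned P Ax | ==-refl (parent P) =
    +1≢ᵇ1 (degIn-pos (remaining P) (without-intro A (leaf P) Ax x≢ℓ) x≢v)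
  ... | no x≢ℓ | no x≢p rewrite degIn-pruned P Ax | ≢⇒==-false x≢p | +-identityʳ (degIn G (A without leaf P) x) =
    leaf-iff-absent (remaining P) (without-intro A (leaf P) Ax x≢ℓ) x≢v

  code-ends-at-root : ∀ {v A k} → Subtree G v A k → LastIs (pruferSteps G v A k) v
  code-ends-at-root {k = zero} _ = tt
  code-ends-at-root {v} {A} {suc j} S =
    subst (λ c → LastIs c v) (sym (pruferSteps-prune P)) (after-parent j (remaining P))
    where
      P = prune S
      after-parent : ∀ i → Subtree G v (A without leaf P) i → LastIs (parent P ∷ pruferSteps G v (A without leaf P) i) v
      after-parent zero    R = countFin-single (size R) (root-alive R) (without-intro A (leaf P) (parent-alive P) (parent≢leaf P))
      after-parent (suc i) R = lastIs-∷ (parent P) (pruferSteps G v (A without leaf P) (suc i)) (code-ends-at-root R)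

  root-in-code : ∀ {v A j} → Subtree G v A (suc j) → v ∈ᵇ toList (pruferSteps G v A (suc j)) ≡ true
  root-in-code {v} {A} {j} S with pruferSteps G v A (suc j) | code-ends-at-root S
  ... | x ∷ xs | last = lastIs-∈ᵇ x xs last

pruferSteps-injective : ∀ {n} {G H : Adj n} → IsForest G → IsForest H → ∀ {v A} k →
                        Subtree G v A k → Subtree H v A k → pruferSteps G v A k ≡ pruferSteps H v A k → AgreeOn A G H
pruferSteps-injective FG FH {v} zero SG _ _ x y Ax Ay
  with countFin-single {x = x} (size SG) (root-alive SG) Ax | countFin-single {x = y} (size SG) (root-alive SG) Ay
... | refl | refl = trans (loopless FG v) (sym (loopless FH v))
pruferSteps-injective {G = G} {H} FG FH {v} {A} (suc j) SG SH codes = agree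
  where
    PG = prune FG SG
    PH = prune FH SH
    same-leaves : ∀ x → isLeaf G v A x ≡ isLeaf H v A x
    same-leaves x with A x in Ax | x ≟ v
    ... | false | _      = refl
    ... | true  | yes _  = refl
    ... | true  | no x≢v = trans (leaf-iff-absent FG SG Ax x≢v)
                             (trans (cong (λ c → not (x ∈ᵇ toList c)) codes) (sym (leaf-iff-absent FH SH Ax x≢v)))
    same-leaf : leaf PG ≡ leaf PH
    same-leaf = just-injective (trans (sym (first-leaf PG)) (trans (firstFin-cong same-leaves) (first-leaf PH)))
    codes′ = trans (sym (pruferSteps-prune PG)) (trans codes (pruferSteps-prune PH))
    same-parent : parent PG ≡ parent PH
    same-parent = ∷-injectiveˡ codes′
    agree-remaining : AgreeOn (A without leaf PG) G H
    agree-remaining = pruferSteps-injective FG FH j (remaining PG)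
      (subst (λ ℓ → Subtree H v (A without ℓ) j) (sym same-leaf) (remaining PH))
      (trans (∷-injectiveʳ codes′) (cong (λ ℓ → pruferSteps H v (A without ℓ) j) (sym same-leaf)))
    edge-to-leafᴴ : ∀ {z} → A z ≡ true → H z (leaf PG) ≡ (z == parent PG)
    edge-to-leafᴴ {z} Az = trans (cong (H z) same-leaf) (trans (edge-to-leaf FH PH Az) (cong (z ==_) (sym same-parent)))
    agree : AgreeOn A G H
    agree x y Ax Ay with x ≟ leaf PG | y ≟ leaf PG
    ... | yes refl | _        = trans (symmetric FG _ y)
                                  (trans (edge-to-leaf FG PG Ay) (sym (trans (symmetric FH _ y) (edge-to-leafᴴ Ay))))
    ... | no _     | yes refl = trans (edge-to-leaf FG PG Ax) (sym (edge-to-leafᴴ Ax))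
    ... | no x≢ℓ   | no y≢ℓ   = agree-remaining x y (without-intro A _ Ax x≢ℓ) (without-intro A _ Ay y≢ℓ)

-- Grafting a leaf, and decoding

module Graft {n} {G′ : Adj n} (F′ : IsForest G′) (A : Fin n → Bool) {ℓ p : Fin n}
             (Aℓ : A ℓ ≡ true) (Ap : A p ≡ true) (p≢ℓ : p ≢ ℓ)
             (edges-alive′ : ∀ x y → G′ x y ≡ true → (A without ℓ) x ≡ true) where

  A′ : Fin n → Bool
  A′ = A without ℓ

  A′p : A′ p ≡ true
  A′p = without-intro A ℓ Ap p≢ℓ

  G : Adj n
  G x y = G′ x y ∨ (x == ℓ) ∧ (y == p) ∨ (x == p) ∧ (y == ℓ)

  ℓ-isolated′ : ∀ y → G′ ℓ y ≡ false
  ℓ-isolated′ y with G′ ℓ y in g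
  ... | false = refl
  ... | true  = ⊥-elim (without-≢ A ℓ (edges-alive′ ℓ y g) refl)

  edge-from-ℓ : ∀ y → G ℓ y ≡ (y == p)
  edge-from-ℓ y rewrite ℓ-isolated′ y | ==-refl ℓ | ≢⇒==-false (≢-sym p≢ℓ) = ∨-identityʳ (y == p)

  ℓ—p : G ℓ p ≡ true
  ℓ—p = trans (edge-from-ℓ p) (==-refl p)

  ℓ-pendant : ∀ y → G ℓ y ≡ true → y ≡ p
  ℓ-pendant y g = ==⇒≡ (trans (sym (edge-from-ℓ y)) g)

  G′⊆G : ∀ {x y} → G′ x y ≡ true → G x y ≡ true
  G′⊆G g rewrite g = refl

  G-agrees : ∀ {x y} → x ≢ ℓ → y ≢ ℓ → G x y ≡ G′ x y
  G-agrees {x} {y} x≢ℓ y≢ℓ rewrite ≢⇒==-false x≢ℓ | ≢⇒==-false y≢ℓ | ∧-zeroʳ (x == p) = ∨-identityʳ (G′ x y)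

  agrees-on-A′ : AgreeOn A′ G G′
  agrees-on-A′ x y x∈ y∈ = G-agrees (without-≢ A ℓ x∈) (without-≢ A ℓ y∈)

  G-symmetric : ∀ x y → G x y ≡ G y x
  G-symmetric x y rewrite symmetric F′ x y = lemma (G′ y x) (x == ℓ) (y == p) (x == p) (y == ℓ)
    where
      lemma : ∀ a b c d e → a ∨ b ∧ c ∨ d ∧ e ≡ a ∨ e ∧ d ∨ c ∧ b
      lemma a b c d e rewrite ∧-comm b c | ∧-comm d e | ∨-comm (c ∧ b) (e ∧ d) = refl

  G-loopless : ∀ x → G x x ≡ false
  G-loopless x = by-cases (x ≟ ℓ)
    where
      by-cases : Dec (x ≡ ℓ) → G x x ≡ false
      by-cases (yes x≡ℓ) = trans (cong (λ t → G t t) x≡ℓ) (trans (edge-from-ℓ ℓ) (≢⇒==-false (≢-sym p≢ℓ)))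
      by-cases (no x≢ℓ)  = trans (G-agrees x≢ℓ x≢ℓ) (loopless F′ x)

  restrict-chain : ∀ {a ys z} → All (ℓ ≢_) (a ∷ ys) → Chain G a ys z → Chain G′ a ys z
  restrict-chain _ end = end
  restrict-chain (ℓ≢a ∷ ℓ≢y ∷ ℓ≢ys) (link g c) =
    link (trans (sym (G-agrees (≢-sym ℓ≢a) (≢-sym ℓ≢y))) g) (restrict-chain (ℓ≢y ∷ ℓ≢ys) c)

  G-acyclic : Acyclic G
  G-acyclic C = acyclic F′ record
    { start = start ; rest = rest ; last = last ; long = long ; distinct = distinct
    ; chain  = restrict-chain off chain
    ; closes = trans (sym (G-agrees (≢-sym (All.lookup off (chain-end∈ chain))) (≢-sym (All.head off)))) closes }
    where
      open Cycle C
      off : All (ℓ ≢_) (start ∷ rest)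
      off = ¬Any⇒All¬ _ (Pendant.pendant-off-cycle G-symmetric ℓ-pendant C)

  G-forest : IsForest G
  G-forest = record { symmetric = G-symmetric ; loopless = G-loopless ; acyclic = G-acyclic }

  G-edges-alive : ∀ x y → G x y ≡ true → A x ≡ true
  G-edges-alive x y g with G′ x y in g′ | x ≟ ℓ | x ≟ p
  ... | true  | _        | _        = without-⊆ A ℓ (edges-alive′ x y g′)
  ... | false | yes refl | _        = Aℓ
  ... | false | no _     | yes refl = Ap
  ... | false | no _     | no _     = ⊥-elim (false≢true g)

  lift : ∀ {x y} → WalkIn G′ A′ x y → WalkIn G A x y
  lift here         = here
  lift (step a g w) = step (without-⊆ A ℓ a) (G′⊆G g) (lift w)

  G-subtree : ∀ {v j} → Subtree G′ v A′ j → Subtree G v A (suc j)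
  G-subtree {v} {j} S′ = record
    { root-alive = without-⊆ A ℓ (root-alive S′)
    ; size       = trans (countFin-remove A ℓ) (trans (cong₂ _+_ (size S′) (cong indicator Aℓ)) (+-comm (suc j) 1))
    ; connected  = connect }
    where
      connect : ConnectedIn G A
      connect x y Ax Ay with x ≟ ℓ | y ≟ ℓ
      ... | yes refl | yes refl = here
      ... | yes refl | no y≢ℓ   = step Ap ℓ—p (lift (connected S′ p y A′p (without-intro A ℓ Ay y≢ℓ)))
      ... | no x≢ℓ   | yes refl =
        lift (connected S′ x p (without-intro A ℓ Ax x≢ℓ) A′p) ++ʷ step Aℓ (trans (G-symmetric p ℓ) ℓ—p) here
      ... | no x≢ℓ   | no y≢ℓ   = lift (connected S′ x y (without-intro A ℓ Ax x≢ℓ) (without-intro A ℓ Ay y≢ℓ))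

  ℓ-neighbour : A p ∧ G ℓ p ≡ true
  ℓ-neighbour = trans (cong (_∧ G ℓ p) Ap) ℓ—p

  ℓ-neighbour-unique : ∀ y → A y ∧ G ℓ y ≡ true → y ≡ p
  ℓ-neighbour-unique y e = ℓ-pendant y (∧-conicalʳ _ _ e)

  degIn-graft : ∀ {x} → A′ x ≡ true → degIn G A x ≡ degIn G′ A′ x + indicator (x == p)
  degIn-graft {x} A′x = trans (degIn-without G x Aℓ)
    (cong₂ _+_ (countFin-cong (alive-neighbours-cong agrees-on-A′ A′x))
               (cong indicator (trans (G-symmetric x ℓ) (edge-from-ℓ x))))

  root-in-new-code : ∀ {v j} → Subtree G′ v A′ j → p ≢ v → v ∈ᵇ toList (pruferSteps G′ v A′ j) ≡ true
  root-in-new-code {j = zero}  S′ p≢v = ⊥-elim (p≢v (countFin-single (size S′) (root-alive S′) A′p))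
  root-in-new-code {j = suc _} S′ _   = root-in-code F′ S′

  parent-not-leaf : ∀ {v j} → Subtree G′ v A′ j → isLeaf G v A p ≡ false
  parent-not-leaf {v} S′ = by-cases (p ≟ v)
    where
      by-cases : Dec (p ≡ v) → isLeaf G v A p ≡ false
      by-cases (yes p≡v) = subst (λ y → isLeaf G v A y ≡ false) (sym p≡v) (isLeaf-root G v A)
      by-cases (no p≢v)  = begin
        isLeaf G v A p                          ≡⟨ isLeaf-test G v A Ap p≢v ⟩
        (degIn G A p ≡ᵇ 1)                      ≡⟨ cong (_≡ᵇ 1) (degIn-graft A′p) ⟩
        (degIn G′ A′ p + indicator (p == p) ≡ᵇ 1) ≡⟨ cong (λ b → degIn G′ A′ p + indicator b ≡ᵇ 1) (==-refl p) ⟩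
        (degIn G′ A′ p + 1 ≡ᵇ 1)                ≡⟨ +1≢ᵇ1 (degIn-pos F′ S′ A′p p≢v) ⟩
        false                                   ∎
        where open ≡-Reasoning

  ℓ-leaf : ∀ {v j} → Subtree G′ v A′ j → isLeaf G v A ℓ ≡ true
  ℓ-leaf {v} S′ = trans (isLeaf-test G v A Aℓ (≢-sym (without-≢ A ℓ (root-alive S′))))
                        (cong (_≡ᵇ 1) (countFin-only ℓ-neighbour ℓ-neighbour-unique))

  ℓ-absent : ∀ {v j} → Subtree G′ v A′ j → ℓ ∈ᵇ toList (p ∷ pruferSteps G′ v A′ j) ≡ false
  ℓ-absent S′ = cong₂ _∨_ (≢⇒==-false (≢-sym p≢ℓ)) (dead-absent F′ S′ (without-self A ℓ))

  leaf-elsewhere : ∀ {v j x} → Subtree G′ v A′ j → A x ≡ true → x ≢ ℓ → x ≢ p → x ≢ v →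
                   isLeaf G v A x ≡ not (x ∈ᵇ toList (p ∷ pruferSteps G′ v A′ j))
  leaf-elsewhere {v} {j} {x} S′ Ax x≢ℓ x≢p x≢v = begin
    isLeaf G v A x                              ≡⟨ isLeaf-test G v A Ax x≢v ⟩
    (degIn G A x ≡ᵇ 1)                          ≡⟨ cong (_≡ᵇ 1) (degIn-graft A′x) ⟩
    (degIn G′ A′ x + indicator (x == p) ≡ᵇ 1)   ≡⟨ cong (λ b → degIn G′ A′ x + indicator b ≡ᵇ 1) (≢⇒==-false x≢p) ⟩
    (degIn G′ A′ x + 0 ≡ᵇ 1)                    ≡⟨ cong (_≡ᵇ 1) (+-identityʳ (degIn G′ A′ x)) ⟩
    (degIn G′ A′ x ≡ᵇ 1)                        ≡⟨ leaf-iff-absent F′ S′ A′x x≢v ⟩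
    not (x ∈ᵇ code′)                            ≡⟨ cong (λ b → not (b ∨ (x ∈ᵇ code′))) (sym (≢⇒==-false x≢p)) ⟩
    not (x ∈ᵇ (p ∷ code′))                      ∎
    where
      open ≡-Reasoning
      code′ = toList (pruferSteps G′ v A′ j)
      A′x = without-intro A ℓ Ax x≢ℓ

  G-leaves : ∀ {v j} → Subtree G′ v A′ j → ∀ x → isLeaf G v A x ≡ (A outside toList (p ∷ pruferSteps G′ v A′ j)) x
  G-leaves {v} {j} S′ x = cases (x ≟ ℓ) (x ≟ p) (x ≟ v) (A x) refl
    where
      code = toList (p ∷ pruferSteps G′ v A′ j)
      Goal : Fin n → Set
      Goal y = isLeaf G v A y ≡ (A outside code) y
      cases : Dec (x ≡ ℓ) → Dec (x ≡ p) → Dec (x ≡ v) → ∀ b → A x ≡ b → Goal x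
      cases (yes x≡ℓ) _ _ _ _ =
        subst Goal (sym x≡ℓ) (trans (ℓ-leaf S′) (sym (outside-intro A code Aℓ (ℓ-absent S′))))
      cases (no _) (yes x≡p) _ _ _ =
        subst Goal (sym x≡p) (trans (parent-not-leaf S′) (sym (outside-present A code p (∷-∈ᵇ-head p (toList (pruferSteps G′ v A′ j))))))
      cases (no _) (no x≢p) (yes x≡v) _ _ =
        subst Goal (sym x≡v) (trans (isLeaf-root G v A) (sym (outside-present A code v
          (trans (cong ((v == p) ∨_) (root-in-new-code S′ (≢-sym (subst (_≢ p) x≡v x≢p)))) (∨-zeroʳ (v == p))))))
      cases (no _) (no _) (no _) false Ax = trans (isLeaf-dead G v A Ax) (sym (outside-dead A code Ax))
      cases (no x≢ℓ) (no x≢p) (no x≢v) true Ax =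
        trans (leaf-elsewhere S′ Ax x≢ℓ x≢p x≢v) (sym (outside-alive A code Ax))

  G-code : ∀ {v j} → Subtree G′ v A′ j → firstFin (A outside toList (p ∷ pruferSteps G′ v A′ j)) ≡ just ℓ →
           pruferSteps G v A (suc j) ≡ p ∷ pruferSteps G′ v A′ j
  G-code {v} {j} S′ first =
    trans (pruferSteps-unfold G v A j (trans (firstFin-cong (G-leaves S′)) first) (firstFin-unique ℓ-neighbour ℓ-neighbour-unique))
          (cong (p ∷_) (pruferSteps-cong j agrees-on-A′))

empty-forest : ∀ {n} → IsForest {n} (λ _ _ → false)
empty-forest {n} = record { symmetric = λ _ _ → refl ; loopless = λ _ → refl ; acyclic = no-cycle }
  where
    no-cycle : Acyclic {n} (λ _ _ → false)
    no-cycle record { rest = [] ; long = () }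
    no-cycle record { rest = _ ∷ _ ; chain = link () _ }

record Decoding {n} (v : Fin n) (A : Fin n → Bool) (k : ℕ) (c : Vec (Fin n) k) : Set where
  field
    graph       : Adj n
    isForest    : IsForest graph
    edges-alive : ∀ x y → graph x y ≡ true → A x ≡ true
    subtree     : Subtree graph v A k
    decodes     : pruferSteps graph v A k ≡ c
open Decoding public

decode : ∀ {n} k (A : Fin n → Bool) v → A v ≡ true → countFin A ≡ suc k → (c : Vec (Fin n) k) →
         (∀ x → x ∈ᵇ toList c ≡ true → A x ≡ true) → LastIs c v → Decoding v A k c
decode zero A v Av size [] _ _ = record
  { graph = λ _ _ → false ; isForest = empty-forest ; edges-alive = λ _ _ () ; decodes = refl
  ; subtree = record
    { root-alive = Av ; size = size
    ; connected  = λ x y Ax Ay → subst₂ (WalkIn _ A) (sym (countFin-single size Av Ax)) (sym (countFin-single size Av Ay)) here } }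
decode (suc j) A v Av size (p ∷ c) entries last = record
  { graph = G ; isForest = G-forest ; edges-alive = G-edges-alive ; subtree = G-subtree (subtree D′)
  ; decodes = trans (G-code (subtree D′) first′) (cong (p ∷_) (decodes D′)) }
  where
    least : ∃ λ ℓ → firstFin (A outside toList (p ∷ c)) ≡ just ℓ
    least = least-absent (p ∷ c) size
    ℓ = proj₁ least
    absent : (A outside toList (p ∷ c)) ℓ ≡ true
    absent = firstFin-sound (proj₂ least)
    Aℓ : A ℓ ≡ true
    Aℓ = ∧-conicalˡ _ _ absent
    ℓ∉ : ℓ ∈ᵇ toList (p ∷ c) ≡ false
    ℓ∉ = not-injective (∧-conicalʳ _ _ absent)
    p≢ℓ : p ≢ ℓ
    p≢ℓ = ≢-sym (==-false⇒≢ (∨-conicalˡ _ _ ℓ∉))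
    ℓ≢v : ℓ ≢ v
    ℓ≢v ℓ≡v = false≢true (trans (sym ℓ∉) (subst (λ t → t ∈ᵇ toList (p ∷ c) ≡ true) (sym ℓ≡v) (lastIs-∈ᵇ p c last)))
    entries′ : ∀ x → x ∈ᵇ toList c ≡ true → (A without ℓ) x ≡ true
    entries′ x x∈ = without-intro A ℓ (entries x (trans (cong ((x == p) ∨_) x∈) (∨-zeroʳ (x == p))))
      λ x≡ℓ → false≢true (trans (sym (∨-conicalʳ _ _ ℓ∉)) (subst (λ t → t ∈ᵇ toList c ≡ true) x≡ℓ x∈))
    D′ : Decoding v (A without ℓ) j c
    D′ = decode j (A without ℓ) v (without-intro A ℓ Av (≢-sym ℓ≢v)) (countFin-without ℓ Aℓ size) c entries′ (lastIs-tail c last)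
    open Graft (isForest D′) A Aℓ (entries p (cong (_∨ (p ∈ᵇ toList c)) (==-refl p))) p≢ℓ (edges-alive D′)
    first′ : firstFin (A outside toList (p ∷ pruferSteps (graph D′) v (A without ℓ) j)) ≡ just ℓ
    first′ = subst (λ c′ → firstFin (A outside toList (p ∷ c′)) ≡ just ℓ) (sym (decodes D′)) (proj₂ least)

-- Type B Prüfer codes

tree-isForest : ∀ {n} (t : BT n) → IsForest (adj t)
tree-isForest t = record
  { symmetric = IsTree.symmetric (isTree t) ; loopless = IsTree.loopless (isTree t) ; acyclic = IsTree.acyclic (isTree t) }

walk⇒walkIn : ∀ {n} {G : Adj n} {x y} → Walk G x y → WalkIn G (λ _ → true) x y
walk⇒walkIn here       = here
walk⇒walkIn (step g w) = step refl g (walk⇒walkIn w)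

walkIn⇒walk : ∀ {n} {G : Adj n} {A x y} → WalkIn G A x y → Walk G x y
walkIn⇒walk here         = here
walkIn⇒walk (step _ g w) = step g (walkIn⇒walk w)

tree-subtree : ∀ {m} (t : BT (suc m)) → Subtree (adj t) (loopAt t) (λ _ → true) m
tree-subtree {m} t = record
  { root-alive = refl ; size = countFin-all (suc m)
  ; connected = λ x y _ _ → walk⇒walkIn (IsTree.connected (isTree t) x y) }

loopAt-from-code : ∀ {m} (s t : BT (suc m)) →
                   pruferSteps (adj s) (loopAt s) (λ _ → true) m ≡ pruferSteps (adj t) (loopAt t) (λ _ → true) m →
                   loopAt s ≡ loopAt t
loopAt-from-code {zero}  s t _     = sym (countFin-single (size (tree-subtree s)) refl refl)
loopAt-from-code {suc m} s t codes = lastIs-unique (pruferSteps (adj t) (loopAt t) (λ _ → true) (suc m))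
  (subst (λ c → LastIs c (loopAt s)) codes (code-ends-at-root (tree-isForest s) (tree-subtree s)))
  (code-ends-at-root (tree-isForest t) (tree-subtree t))

pruferB-injective : ∀ {m} (s t : BT (suc m)) → pruferB s ≡ pruferB t → s ≈BT t
pruferB-injective {m} s t eq = same-edges , ∷-injectiveˡ eq , same-loop
  where
    same-loop : loopAt s ≡ loopAt t
    same-loop = loopAt-from-code s t (∷-injectiveʳ eq)
    same-edges : ∀ x y → adj s x y ≡ adj t x y
    same-edges x y = pruferSteps-injective (tree-isForest s) (tree-isForest t) m (tree-subtree s)
      (subst (λ w → Subtree (adj t) w (λ _ → true) m) (sym same-loop) (tree-subtree t))
      (trans (∷-injectiveʳ eq) (cong (λ w → pruferSteps (adj t) w (λ _ → true) m) (sym same-loop))) x y refl refl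

pruferB-surjective : ∀ {m} (b : Vec (Fin (suc m)) (suc m)) → Σ (BT (suc m)) (λ t → pruferB t ≡ b)
pruferB-surjective {m} (r ∷ c) = tree , cong (r ∷_) (decodes D)
  where
    -- The default zero matters only when m = 0, where it is the only vertex.
    last = lastIs-exists zero c
    D = decode m (λ _ → true) (proj₁ last) refl (countFin-all (suc m)) c (λ _ _ → refl) (proj₂ last)
    tree : BT (suc m)
    tree = record
      { adj = graph D ; root = r ; loopAt = proj₁ last
      ; isTree = record
        { symmetric = symmetric (isForest D) ; loopless = loopless (isForest D) ; acyclic = acyclic (isForest D)
        ; connected = λ x y → walkIn⇒walk (connected (subtree D) x y refl refl) } }

mainTheorem8 : (m : ℕ)
    → ((s t : BT (suc m)) → pruferB s ≡ pruferB t → s ≈BT t)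
      × ((b : Vec (Fin (suc m)) (suc m)) → Σ (BT (suc m)) (λ t → pruferB t ≡ b))
mainTheorem8 m = pruferB-injective , pruferB-surjective
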